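{- For all $n\ge 2$, $\beta(P_\infty\Box P_n)=2$, and $S=\{(0,0),(0,n-1)\}$ is a metric basis of $P_\infty\Box P_n$.
   Context: $P_\infty$ has vertex set $\mathbb{N}=\{0,1,2,\dots\}$ and $P_n$ has vertex set $\{0,1,\dots,n-1\}$; in each, $i,j$ are adjacent iff $|i-j|=1$. The cartesian product $G\Box H$ has vertex set $V(G)\times V(H)$, with $(a,v)$ adjacent to $(b,w)$ iff either $a=b$ and $vw\in E(H)$, or $v=w$ and $ab\in E(G)$. $d$ is the shortest-path distance. A vertex $x$ resolves $u,v$ if $d(u,x)\neq d(v,x)$; a set $S$ is a resolving set if every pair of distinct vertices is resolved by some vertex of $S$; a metric basis is a resolving set of minimum cardinality and $\beta$ (metric dimension) is its cardinality (infinite if no finite resolving set exists). -}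

module Defs where

open import Data.Nat using (ℕ; zero; suc; _≤_; _<_; _∸_; s≤s; z≤n)
open import Data.Fin using (Fin; toℕ; fromℕ; zero)
open import Data.Product using (Σ; _×_; _,_; ∃)
open import Data.Sum using (_⊎_)
open import Relation.Binary.PropositionalEquality using (_≡_; _≢_)
open import Function.Definitions using (Injective)

record Graph : Set₁ where
  field
    V   : Set
    Adj : V → V → Set
open Graph public

Adj1 : ℕ → ℕ → Set
Adj1 i j = (suc i ≡ j) ⊎ (suc j ≡ i)

P∞ : Graph
P∞ = record { V = ℕ ; Adj = Adj1 }

P : ℕ → Graph
P n = record { V = Fin n ; Adj = λ i j → Adj1 (toℕ i) (toℕ j) }

_□_ : Graph → Graph → Graph
G □ H = record
  { V   = V G × V H
  ; Adj = λ { (a , v) (b , w) → (a ≡ b × Adj H v w) ⊎ (v ≡ w × Adj G a b) } }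

data Walk (G : Graph) : V G → V G → ℕ → Set where
  here : ∀ {u} → Walk G u u 0
  step : ∀ {u w v k} → Adj G u w → Walk G w v k → Walk G u v (suc k)

Dist : (G : Graph) → V G → V G → ℕ → Set
Dist G u v k = Walk G u v k × (∀ m → Walk G u v m → k ≤ m)

Resolves : (G : Graph) → V G → V G → V G → Set
Resolves G x u v = ∀ k₁ k₂ → Dist G u x k₁ → Dist G v x k₂ → k₁ ≢ k₂

VSet : Graph → Set₁
VSet G = V G → Set

IsResolving : (G : Graph) → VSet G → Set
IsResolving G S = ∀ u v → u ≢ v → Σ (V G) λ x → S x × Resolves G x u v

AtLeast : (G : Graph) → VSet G → ℕ → Set
AtLeast G S k = Σ (Fin k → V G) λ f → (∀ i → S (f i)) × Injective _≡_ _≡_ f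

AtMost : (G : Graph) → VSet G → ℕ → Set
AtMost G S k = Σ (Fin k → V G) λ f → ∀ x → S x → Σ (Fin k) λ i → f i ≡ x

HasCard : (G : Graph) → VSet G → ℕ → Set
HasCard G S k = AtLeast G S k × AtMost G S k

IsMetricBasis : (G : Graph) → VSet G → Set₁
IsMetricBasis G S =
  IsResolving G S ×
  Σ ℕ λ m → HasCard G S m × (∀ (T : VSet G) → IsResolving G T → AtLeast G T m)

MetricDim : Graph → ℕ → Set₁
MetricDim G k = Σ (VSet G) λ S → IsMetricBasis G S × HasCard G S k

first : ∀ {n} → 2 ≤ n → Fin n
first {suc n} _ = zero

last : ∀ {n} → 2 ≤ n → Fin n
last {suc n} _ = fromℕ n   -- toℕ (fromℕ n) = n = (suc n) - 1

-- Distances are handled through a function δ that is realised by a walk and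
-- bounds the length of every walk (`IsDistance`); then Dist G u v (δ u v)
-- holds and "x resolves u, v" becomes δ u x ≢ δ v x.  Walks come from a
-- descent recipe (δ can always be lowered by one along an edge), minimality
-- from a Lipschitz recipe (δ grows by at most one along an edge).  This gives
-- ∣ i - j ∣ on P∞ and P n and the sum of factor distances on a cartesian
-- product, so the grid P∞ □ P n carries the Manhattan distance.
--
-- Upper bound: the distances a + i and a + (n-1-i) of (a,i) to the two
-- corners determine a and i.  Lower bound: every grid vertex is equidistant
-- from two distinct vertices, so no vertex resolves the grid on its own and
-- every resolving set has at least two elements.

module Submission where

open import Defs
open import Data.Nat using (ℕ; zero; suc; _+_; _∸_; _≤_; _<_; s≤s; z≤n; ∣_-_∣; ⌊_/2⌋; s≤s⁻¹)
open import Data.Nat.Properties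
open import Data.Fin using (Fin; toℕ; fromℕ; fromℕ<; inject₁) renaming (zero to fzero; suc to fsuc)
open import Data.Fin.Properties using (toℕ-injective; toℕ<n; toℕ-fromℕ; toℕ-fromℕ<; toℕ-inject₁)
open import Data.Product using (Σ; _×_; _,_; proj₁)
open import Data.Sum using (_⊎_; inj₁; inj₂; [_,_]) renaming (map to ⊎-map)
open import Data.Empty using (⊥-elim)
open import Relation.Binary.PropositionalEquality using (_≡_; _≢_; refl; sym; trans; cong; cong₂; subst; module ≡-Reasoning)
open import Relation.Nullary using (¬_; yes; no)
open import Algebra.Properties.CommutativeSemigroup +-commutativeSemigroup using (interchange)

mapWalk : {G H : Graph} (f : V G → V H) →
          (∀ {u w} → Adj G u w → Adj H (f u) (f w)) →
          ∀ {u v k} → Walk G u v k → Walk H (f u) (f v) k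
mapWalk f hom here         = here
mapWalk f hom (step adj w) = step (hom adj) (mapWalk f hom w)

_++ʷ_ : {G : Graph} {u w v : V G} {j k : ℕ} → Walk G u w j → Walk G w v k → Walk G u v (j + k)
here         ++ʷ w′ = w′
(step adj w) ++ʷ w′ = step adj (w ++ʷ w′)

record IsDistance (G : Graph) (δ : V G → V G → ℕ) : Set where
  field
    realised : ∀ u v → Walk G u v (δ u v)
    minimal  : ∀ {u v m} → Walk G u v m → δ u v ≤ m

module DistanceFacts {G : Graph} {δ : V G → V G → ℕ} (isDist : IsDistance G δ) where
  open IsDistance isDist

  dist : ∀ u v → Dist G u v (δ u v)
  dist u v = realised u v , λ m w → minimal w

  dist-unique : ∀ {u v k} → Dist G u v k → k ≡ δ u v
  dist-unique {u} {v} (w , shortest) = ≤-antisym (shortest (δ u v) (realised u v)) (minimal w)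

  resolves-if : ∀ {x u v} → δ u x ≢ δ v x → Resolves G x u v
  resolves-if ne k₁ k₂ d₁ d₂ k₁≡k₂ = ne (trans (sym (dist-unique d₁)) (trans k₁≡k₂ (dist-unique d₂)))

  unresolved : ∀ {x u v} → δ u x ≡ δ v x → ¬ Resolves G x u v
  unresolved {x} {u} {v} eq r = r (δ u x) (δ v x) (dist u x) (dist v x) eq

  lipschitz : ∀ {u w v} → Adj G u w → δ u v ≤ suc (δ w v)
  lipschitz {w = w} {v} adj = minimal (step adj (realised w v))

  self : ∀ u → δ u u ≡ 0
  self u = n≤0⇒n≡0 (minimal here)

minimal-by-lipschitz : {G : Graph} (δ : V G → V G → ℕ) →
  (∀ u → δ u u ≡ 0) → (∀ {u w v} → Adj G u w → δ u v ≤ suc (δ w v)) →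
  ∀ {u v m} → Walk G u v m → δ u v ≤ m
minimal-by-lipschitz δ self lip {u} here = ≤-reflexive (self u)
minimal-by-lipschitz δ self lip (step adj w) = ≤-trans (lip adj) (s≤s (minimal-by-lipschitz δ self lip w))

realised-by-descent : {G : Graph} (δ : V G → V G → ℕ) →
  (∀ {u v} → δ u v ≡ 0 → u ≡ v) →
  (∀ {u v k} → δ u v ≡ suc k → Σ (V G) λ w → Adj G u w × δ w v ≡ k) →
  ∀ u v → Walk G u v (δ u v)
realised-by-descent {G} δ zero-diag descend u v = go (δ u v) refl
  where
  go : ∀ {u} k → δ u v ≡ k → Walk G u v k
  go zero    eq with zero-diag eq
  ... | refl = here
  go (suc k) eq with descend eq
  ... | w , adj , eq′ = step adj (go k eq′)

adj1-unit : ∀ {a c} → Adj1 a c → ∣ a - c ∣ ≡ 1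
adj1-unit {a} (inj₁ refl) = below a
  where
  below : ∀ k → ∣ k - suc k ∣ ≡ 1
  below zero    = refl
  below (suc k) = below k
adj1-unit {a} {c} (inj₂ refl) = trans (∣-∣-comm a c) (adj1-unit {c} (inj₁ refl))

adj1-lipschitz : ∀ {a c} b → Adj1 a c → ∣ a - b ∣ ≤ suc ∣ c - b ∣
adj1-lipschitz {a} {c} b adj = ≤-trans (∣-∣-triangle a c b) (+-monoˡ-≤ ∣ c - b ∣ (≤-reflexive (adj1-unit adj)))

ℕ-descent : ∀ a b {k} → ∣ a - b ∣ ≡ suc k →
  Σ ℕ λ c → Adj1 a c × ∣ c - b ∣ ≡ k × (c ≤ a ⊎ c ≤ b)
ℕ-descent zero    (suc b) refl = 1 , inj₁ refl , refl , inj₂ (s≤s z≤n)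
ℕ-descent (suc a) zero    refl = a , inj₂ refl , ∣-∣-identityʳ a , inj₁ (n≤1+n a)
ℕ-descent (suc a) (suc b) eq with ℕ-descent a b eq
... | c , adj , eq′ , between = suc c , ⊎-map (cong suc) (cong suc) adj , eq′ , ⊎-map s≤s s≤s between

path∞-distance : IsDistance P∞ ∣_-_∣
path∞-distance = record
  { realised = realised-by-descent ∣_-_∣ ∣m-n∣≡0⇒m≡n (λ {a} {b} eq → descend a b eq)
  ; minimal  = minimal-by-lipschitz ∣_-_∣ ∣n-n∣≡0 (λ {_} {_} {b} → adj1-lipschitz b)
  }
  where
  descend : ∀ a b {k} → ∣ a - b ∣ ≡ suc k → Σ ℕ λ c → Adj1 a c × ∣ c - b ∣ ≡ k
  descend a b eq with ℕ-descent a b eq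
  ... | c , adj , eq′ , _ = c , adj , eq′

fin-descent : ∀ {n} (i j : Fin n) {k} → ∣ toℕ i - toℕ j ∣ ≡ suc k →
  Σ (Fin n) λ l → Adj1 (toℕ i) (toℕ l) × ∣ toℕ l - toℕ j ∣ ≡ k
fin-descent i j eq with ℕ-descent (toℕ i) (toℕ j) eq
... | c , adj , eq′ , between =
  fromℕ< c<n , subst (Adj1 (toℕ i)) (sym c≡l) adj , subst (λ t → ∣ t - toℕ j ∣ ≡ _) (sym c≡l) eq′
  where
  c<n : c < _
  c<n = [ (λ c≤i → ≤-<-trans c≤i (toℕ<n i)) , (λ c≤j → ≤-<-trans c≤j (toℕ<n j)) ] between
  c≡l : toℕ (fromℕ< c<n) ≡ c
  c≡l = toℕ-fromℕ< c<n

-- The distance of P n is ∣ i - j ∣; minimality is inherited from P∞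
-- through the inclusion toℕ, which is a graph homomorphism.
path-distance : ∀ n → IsDistance (P n) (λ i j → ∣ toℕ i - toℕ j ∣)
path-distance n = record
  { realised = realised-by-descent (λ i j → ∣ toℕ i - toℕ j ∣) (λ eq → toℕ-injective (∣m-n∣≡0⇒m≡n eq))
                                   (λ {i} {j} eq → fin-descent i j eq)
  ; minimal  = λ w → IsDistance.minimal path∞-distance (mapWalk {P n} {P∞} toℕ (λ adj → adj) w)
  }

productδ : {A B : Set} → (A → A → ℕ) → (B → B → ℕ) → A × B → A × B → ℕ
productδ δG δH (a , v) (b , w) = δG a b + δH v w

product-distance : {G H : Graph} {δG : V G → V G → ℕ} {δH : V H → V H → ℕ} →
  IsDistance G δG → IsDistance H δH → IsDistance (G □ H) (productδ δG δH)
product-distance {G} {H} {δG} {δH} distG distH = record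
  { realised = λ { (a , v) (b , w) → along-G v (realised distG a b) ++ʷ along-H b (realised distH v w) }
  ; minimal  = minimal-by-lipschitz (productδ δG δH) self-sum lip
  }
  where
  open IsDistance
  module DG = DistanceFacts distG
  module DH = DistanceFacts distH

  along-G : ∀ v {a b k} → Walk G a b k → Walk (G □ H) (a , v) (b , v) k
  along-G v = mapWalk (λ a → a , v) (λ adj → inj₂ (refl , adj))

  along-H : ∀ a {v w k} → Walk H v w k → Walk (G □ H) (a , v) (a , w) k
  along-H a = mapWalk (λ v → a , v) (λ adj → inj₁ (refl , adj))

  self-sum : ∀ x → productδ δG δH x x ≡ 0
  self-sum (a , v) = cong₂ _+_ (DG.self a) (DH.self v)

  lip : ∀ {x y z} → Adj (G □ H) x y → productδ δG δH x z ≤ suc (productδ δG δH y z)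
  lip {a , v} {_ , w} {b , u} (inj₁ (refl , adj)) =
    ≤-trans (+-monoʳ-≤ (δG a b) (DH.lipschitz adj)) (≤-reflexive (+-suc (δG a b) (δH w u)))
  lip {a , v} {_ , _} {b , u} (inj₂ (refl , adj)) = +-monoˡ-≤ (δH v u) (DG.lipschitz adj)

Pair : {A : Set} → A → A → A → Set
Pair x y z = (z ≡ x) ⊎ (z ≡ y)

enumerate : {A : Set} → A → A → Fin 2 → A
enumerate x y fzero        = x
enumerate x y (fsuc fzero) = y

pair-atMost : {G : Graph} (x y : V G) → AtMost G (Pair x y) 2
pair-atMost x y = enumerate x y , λ { _ (inj₁ refl) → fzero , refl ; _ (inj₂ refl) → fsuc fzero , refl }

two-elements : {G : Graph} {T : VSet G} {x y : V G} → T x → T y → x ≢ y → AtLeast G T 2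
two-elements {G} {T} {x} {y} x∈T y∈T x≢y = enumerate x y , members , injective
  where
  members : ∀ i → T (enumerate x y i)
  members fzero        = x∈T
  members (fsuc fzero) = y∈T
  injective : ∀ {i j} → enumerate x y i ≡ enumerate x y j → i ≡ j
  injective {fzero}      {fzero}      _ = refl
  injective {fzero}      {fsuc fzero} e = ⊥-elim (x≢y e)
  injective {fsuc fzero} {fzero}      e = ⊥-elim (x≢y (sym e))
  injective {fsuc fzero} {fsuc fzero} _ = refl

-- If every vertex is equidistant from some pair of distinct vertices, then
-- no single vertex resolves G, so every resolving set has two elements:
-- a member x₁ exists, and the pair blind to x₁ is resolved by another one.
module LowerBound {G : Graph} {δ : V G → V G → ℕ} (isDist : IsDistance G δ) where
  open DistanceFacts isDist

  Blind : V G → Set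
  Blind x = Σ (V G) λ p → Σ (V G) λ q → p ≢ q × δ p x ≡ δ q x

  resolving-has-two : V G → (∀ x → Blind x) → ∀ T → IsResolving G T → AtLeast G T 2
  resolving-has-two x₀ blind T resolving with blind x₀
  ... | p , q , p≢q , _ with resolving p q p≢q
  ... | x₁ , x₁∈T , _ with blind x₁
  ... | p′ , q′ , p′≢q′ , equidistant with resolving p′ q′ p′≢q′
  ... | x₂ , x₂∈T , resolves = two-elements {G = G} {T = T} x₁∈T x₂∈T λ { refl → unresolved equidistant resolves }

-- Distances to the corners: summing a + i and a + (N ∸ i) recovers a,
-- after which the first one recovers i.
corner-sum : ∀ a {i N} → i ≤ N → (a + i) + (a + (N ∸ i)) ≡ (a + a) + N
corner-sum a {i} {N} i≤N = begin
  (a + i) + (a + (N ∸ i)) ≡⟨ interchange a i a (N ∸ i) ⟩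
  (a + a) + (i + (N ∸ i)) ≡⟨ cong ((a + a) +_) (m+[n∸m]≡n i≤N) ⟩
  (a + a) + N             ∎
  where open ≡-Reasoning

corner-coordinates : ∀ {N a b i j} → i ≤ N → j ≤ N →
  a + i ≡ b + j → a + (N ∸ i) ≡ b + (N ∸ j) → a ≡ b × i ≡ j
corner-coordinates {N} {a} {b} {i} {j} i≤N j≤N eq₀ eq₁ = a≡b , i≡j
  where
  doubled : a + a ≡ b + b
  doubled = +-cancelʳ-≡ N (a + a) (b + b)
    (trans (sym (corner-sum a i≤N)) (trans (cong₂ _+_ eq₀ eq₁) (corner-sum b j≤N)))
  a≡b : a ≡ b
  a≡b = trans (n≡⌊n+n/2⌋ a) (trans (cong ⌊_/2⌋ doubled) (sym (n≡⌊n+n/2⌋ b)))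
  i≡j : i ≡ j
  i≡j = +-cancelˡ-≡ a i j (trans eq₀ (cong (_+ j) (sym a≡b)))

gridδ : ∀ n → V (P∞ □ P n) → V (P∞ □ P n) → ℕ
gridδ n = productδ ∣_-_∣ (λ i j → ∣ toℕ i - toℕ j ∣)

grid-distance : ∀ n → IsDistance (P∞ □ P n) (gridδ n)
grid-distance n = product-distance path∞-distance (path-distance n)

module Corners (N : ℕ) where
  open DistanceFacts (grid-distance (suc N))

  Grid : Graph
  Grid = P∞ □ P (suc N)

  c₀ c₁ : V Grid
  c₀ = 0 , fzero
  c₁ = 0 , fromℕ N

  index≤N : (k : Fin (suc N)) → toℕ k ≤ N
  index≤N k = s≤s⁻¹ (toℕ<n k)

  to-c₀ : ∀ a k → gridδ (suc N) (a , k) c₀ ≡ a + toℕ k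
  to-c₀ a k = cong₂ _+_ (∣-∣-identityʳ a) (∣-∣-identityʳ (toℕ k))

  to-c₁ : ∀ a k → gridδ (suc N) (a , k) c₁ ≡ a + (N ∸ toℕ k)
  to-c₁ a k = cong₂ _+_ (∣-∣-identityʳ a)
    (trans (cong (∣ toℕ k -_∣) (toℕ-fromℕ N)) (m≤n⇒∣m-n∣≡n∸m (index≤N k)))

  corners-resolve : IsResolving Grid (Pair c₀ c₁)
  corners-resolve (a , i) (b , j) u≢v
    with gridδ (suc N) (a , i) c₀ ≟ gridδ (suc N) (b , j) c₀
       | gridδ (suc N) (a , i) c₁ ≟ gridδ (suc N) (b , j) c₁
  ... | no ne   | _       = c₀ , inj₁ refl , resolves-if ne
  ... | yes _   | no ne   = c₁ , inj₂ refl , resolves-if ne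
  ... | yes eq₀ | yes eq₁
    with corner-coordinates (index≤N i) (index≤N j)
           (trans (sym (to-c₀ a i)) (trans eq₀ (to-c₀ b j)))
           (trans (sym (to-c₁ a i)) (trans eq₁ (to-c₁ b j)))
  ... | refl , i≡j = ⊥-elim (u≢v (cong (a ,_) (toℕ-injective i≡j)))

-- In a grid with at least two columns, (a,i) is at distance 1 from both
-- (a+1,i) and (a,i′) for a vertical neighbour i′ of i.
grid-blind : ∀ m x → LowerBound.Blind (grid-distance (suc (suc m))) x
grid-blind m (a , i) =
  (suc a , i) , (a , neighbour i) , (λ e → 1+n≢n (cong proj₁ e)) ,
  trans (cong₂ _+_ (adj1-unit {suc a} (inj₂ refl)) (∣n-n∣≡0 (toℕ i)))
        (sym (cong₂ _+_ (∣n-n∣≡0 a) (adj1-unit (neighbour-adj i))))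
  where
  neighbour : Fin (suc (suc m)) → Fin (suc (suc m))
  neighbour fzero    = fsuc fzero
  neighbour (fsuc k) = inject₁ k
  neighbour-adj : ∀ k → Adj1 (toℕ (neighbour k)) (toℕ k)
  neighbour-adj fzero    = inj₂ refl
  neighbour-adj (fsuc k) = inj₁ (cong suc (toℕ-inject₁ k))

proposition4 : (n : ℕ) → (h : 2 ≤ n) →
    MetricDim (P∞ □ P n) 2 ×
    IsMetricBasis (P∞ □ P n) (λ x → (x ≡ (0 , first h)) ⊎ (x ≡ (0 , last h)))
proposition4 zero ()
proposition4 (suc zero) (s≤s ())
proposition4 (suc (suc m)) h = (corners , basis , card) , basis
  where
  open Corners (suc m) using (Grid; c₀; c₁; corners-resolve)
  corners : VSet Grid
  corners = Pair c₀ c₁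
  card : HasCard Grid corners 2
  card = two-elements {G = Grid} {T = corners} (inj₁ refl) (inj₂ refl) (λ ()) , pair-atMost {G = Grid} c₀ c₁
  basis : IsMetricBasis Grid corners
  basis = corners-resolve , 2 , card ,
          LowerBound.resolving-has-two (grid-distance (suc (suc m))) c₀ (grid-blind m)
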